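{- For each integer $n\ge 1$ there exist a binary word $w_n$ and a fold $P_n$ of $w_n$ in the 2D rectangular lattice $\mathbb Z^2$ such that the set of lattice points occupied by the zeros of $w_n$ under $P_n$ is exactly a $(2n+1)\times(2n+1)$ square $\{a,a+1,\dots,a+2n\}\times\{b,b+1,\dots,b+2n\}$ for some $a,b\in\mathbb Z$, and $w_n$ does not contain $0^{2n+1}$ (the word of $2n+1$ consecutive zeros) as a contiguous subword.
   Context: Words are finite strings over $\{0,1\}$. A fold of a word $w=w_1\cdots w_n$ in $\mathbb Z^2$ is a self-avoiding walk $v_1,\dots,v_n$ in the nearest-neighbour graph $\mathbb Z^2$ (distinct vertices, $v_i$ adjacent to $v_{i+1}$), with $v_i$ labelled $w_i$. -}

module Defs where

open import Data.Nat using (ℕ; suc; _+_; _*_)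
open import Data.Integer as ℤ using (ℤ; +_; ∣_∣)
open import Data.Fin using (Fin; zero; suc; toℕ; inject₁)
open import Data.Product using (Σ; ∃; ∃-syntax; _×_; _,_)
open import Data.Sum using (_⊎_)
open import Data.List using (List; _++_; replicate)
open import Data.Vec using (Vec; lookup; toList)
open import Relation.Binary.PropositionalEquality using (_≡_)
open import Relation.Nullary using (¬_)

data Bit : Set where
  b0 b1 : Bit

Word : ℕ → Set
Word m = Vec Bit m

Point : Set
Point = ℤ × ℤ

Adjacent : Point → Point → Set
Adjacent (x , y) (x' , y') = ∣ x ℤ.- x' ∣ + ∣ y ℤ.- y' ∣ ≡ 1

record SAW (m : ℕ) : Set where
  field
    vertex   : Vec Point m
    distinct : ∀ (i j : Fin m) → lookup vertex i ≡ lookup vertex j → i ≡ j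
    steps    : ∀ (i : Fin m) (j : Fin m) → toℕ j ≡ suc (toℕ i) →
               Adjacent (lookup vertex i) (lookup vertex j)

-- a fold of a word w of length m: a self-avoiding walk of the same length,
-- vertex v_i labelled w_i
Fold : ∀ {m} → Word m → Set
Fold {m} w = SAW m

OccupiedByZero : ∀ {m} (w : Word m) → Fold w → Point → Set
OccupiedByZero {m} w P p =
  ∃[ i ] (lookup w i ≡ b0 × lookup (SAW.vertex P) i ≡ p)

InSquare : ℤ → ℤ → ℕ → Point → Set
InSquare a b k (x , y) =
  (a ℤ.≤ x × x ℤ.≤ a ℤ.+ + k) × (b ℤ.≤ y × y ℤ.≤ b ℤ.+ + k)

Factor : List Bit → List Bit → Set
Factor u w = ∃[ l ] ∃[ r ] (w ≡ l ++ u ++ r)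

-- The square [0, 2n]² is cut into the half row [0, n] × {n} and, in pinwheel position, one
-- n × n corner block and three quarter-turned copies of an n × (n + 1) corner block.
-- A corner block [0, k] × [0, k + s] is the union of the L-shaped hooks
-- {m} × [0, m + s] ∪ [0, m) × {m + s}, m = k, …, 0. The walk runs through them alternately
-- upwards and downwards, stepping from each hook to the next through two ones just outside
-- the block (on the column x = -1 or on the row y = -1), so every run of zeros is a hook or
-- the half row and has length at most 2n. Whichever hook comes last, the walk leaves the
-- block along the column x = -2 to the same exit point, which lies next to the start of the
-- following turned block. The five pieces occupy pairwise disjoint regions, and inside a
-- block hook m + 1 avoids the box [0, m] × [0, m + s] filled by the smaller hooks, so the
-- walk is self-avoiding.

module Submission where

open import Defs
open import Data.Nat using (ℕ; zero; suc; _+_; _*_; _∸_; _≥_; _≤_; _<_; z≤n; s≤s)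
import Data.Nat.Properties as ℕP
open import Data.Integer as ℤ using (ℤ; +_; -[1+_]; ∣_∣; 0ℤ; -1ℤ)
import Data.Integer.Properties as ℤP
open import Data.Integer.Tactic.RingSolver using (solve-∀)
import Data.Nat.Tactic.RingSolver as ℕSolver
open import Data.Product using (Σ; ∃-syntax; _×_; _,_; proj₁; proj₂; map₂)
open import Data.Product.Properties using (,-injectiveˡ; ,-injectiveʳ)
open import Data.List as L using (List; []; _∷_; _++_; [_]; length; replicate; applyUpTo; applyDownFrom)
import Data.List.Properties as LP
open import Data.List.Relation.Unary.All as All using (All; []; _∷_)
import Data.List.Relation.Unary.All.Properties as AllP
open import Data.List.Relation.Unary.Any using (Any; here; there)
import Data.List.Relation.Unary.Any.Properties as AnyP
open import Data.List.Relation.Unary.Unique.Propositional using (Unique)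
open import Data.List.Relation.Unary.AllPairs as AllPairs using (AllPairs; []; _∷_)
import Data.List.Relation.Unary.AllPairs.Properties as AllPairsP
open import Data.List.Membership.Propositional using (_∈_)
open import Data.List.Membership.Propositional.Properties
  using (∈-map⁺; ∈-map⁻; ∈-++⁺ˡ; ∈-++⁺ʳ; ∈-++⁻; ∈-concat⁺; ∈-concat⁻′)
open import Data.Fin using (toℕ) renaming (zero to fzero; suc to fsuc)
import Data.Vec as V
open import Data.Vec using (toList)
open import Data.Empty using (⊥; ⊥-elim)
open import Data.Sum using (_⊎_; inj₁; inj₂)
open import Function using (_∘_)
open import Function.Definitions using (Injective)
open import Function.Properties.Equivalence using () renaming (trans to ⇔-trans)
open import Function.Bundles using (_⇔_; mk⇔)
open import Relation.Binary.PropositionalEquality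
  using (_≡_; _≢_; refl; sym; trans; cong; cong₂; subst; subst₂)
open import Relation.Nullary using (¬_; yes; no)

-- Neighbours and walks in ℤ²

infix 4 _∼_

-- A record rather than the bare equation (likewise _≉_ below), so that the arguments stay inferable.
record _∼_ (p q : Point) : Set where
  constructor adj
  field adjacent : Adjacent p q
open _∼_

∼-sym : ∀ {p q} → p ∼ q → q ∼ p
∼-sym {x , y} {x′ , y′} (adj e) =
  adj (subst₂ (λ u v → u + v ≡ 1) (ℤP.∣i-j∣≡∣j-i∣ x x′) (ℤP.∣i-j∣≡∣j-i∣ y y′) e)

i-suc[i]≡-1 : ∀ i → i ℤ.- (ℤ.1ℤ ℤ.+ i) ≡ -1ℤ
i-suc[i]≡-1 = solve-∀

∼-up : ∀ x y → (x , y) ∼ (x , ℤ.suc y)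
∼-up x y = adj (cong₂ (λ u v → ∣ u ∣ + ∣ v ∣) (ℤP.+-inverseʳ x) (i-suc[i]≡-1 y))

∼-right : ∀ x y → (x , y) ∼ (ℤ.suc x , y)
∼-right x y = adj (cong₂ (λ u v → ∣ u ∣ + ∣ v ∣) (i-suc[i]≡-1 x) (ℤP.+-inverseʳ y))

∼-down : ∀ x y → (x , ℤ.suc y) ∼ (x , y)
∼-down x y = ∼-sym (∼-up x y)

∼-left : ∀ x y → (ℤ.suc x , y) ∼ (x , y)
∼-left x y = ∼-sym (∼-right x y)

points : List (Bit × Point) → List Point
points = L.map proj₂

word : List (Bit × Point) → List Bit
word = L.map proj₁

data Walk : Point → List (Bit × Point) → Point → Set where
  stop : ∀ {b p} → Walk p [ b , p ] p
  step : ∀ {b p q W r} → p ∼ q → Walk q W r → Walk p ((b , p) ∷ W) r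

walk-++ : ∀ {p W q r V t} → Walk p W q → q ∼ r → Walk r V t → Walk p (W ++ V) t
walk-++ stop      q∼r V = step q∼r V
walk-++ (step a W) q∼r V = step a (walk-++ W q∼r V)

walk-++-[] : ∀ {p W q} → Walk p W q → Walk p (W ++ []) q
walk-++-[] {p} {W} {q} w = subst (λ V → Walk p V q) (sym (LP.++-identityʳ W)) w

mapPoints : (Point → Point) → List (Bit × Point) → List (Bit × Point)
mapPoints f = L.map (map₂ f)

walk-map : ∀ (f : Point → Point) → (∀ {p q} → p ∼ q → f p ∼ f q) →
           ∀ {p W q} → Walk p W q → Walk (f p) (mapPoints f W) (f q)
walk-map f f-∼ stop       = stop
walk-map f f-∼ (step a W) = step (f-∼ a) (walk-map f f-∼ W)

infix 4 _≉_

record _≉_ (e e′ : Bit × Point) : Set where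
  constructor distinct
  field points-differ : proj₂ e ≢ proj₂ e′

SelfAvoiding : List (Bit × Point) → Set
SelfAvoiding = AllPairs _≉_

Apart : (Bit × Point → Set) → (Bit × Point → Set) → Set
Apart P Q = ∀ {e e′} → P e → Q e′ → proj₂ e ≢ proj₂ e′

apart-all : ∀ {P Q : Bit × Point → Set} {W V} → All P W → All Q V → Apart P Q →
            All (λ e → All (e ≉_) V) W
apart-all PW QV apart = All.map (λ pe → All.map (distinct ∘ apart pe) QV) PW

selfAvoiding-++ : ∀ {P Q : Bit × Point → Set} {W V} → All P W → All Q V → Apart P Q →
                  SelfAvoiding W → SelfAvoiding V → SelfAvoiding (W ++ V)
selfAvoiding-++ PW QV apart sW sV = AllPairsP.++⁺ sW sV (apart-all PW QV apart)

avoids : ∀ {R : Bit × Point → Set} {e W} → (∀ {b} → ¬ R (b , proj₂ e)) → All R W → All (e ≉_) W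
avoids ¬R = All.map λ { {b , _} r → distinct λ { refl → ¬R r } }

selfAvoiding-mapPoints : ∀ f → Injective _≡_ _≡_ f → ∀ {W} →
                         SelfAvoiding W → SelfAvoiding (mapPoints f W)
selfAvoiding-mapPoints f inj sa = AllPairsP.map⁺ (AllPairs.map (λ (distinct d) → distinct (d ∘ inj)) sa)

Separated : (Point → Set) → (Point → Set) → Set
Separated P Q = ∀ {p} → P p → Q p → ⊥

separated-all : ∀ {P Q : Point → Set} {W V} →
                All (P ∘ proj₂) W → All (Q ∘ proj₂) V → Separated P Q →
                All (λ e → All (e ≉_) V) W
separated-all PW QV sep = apart-all PW QV λ { Pe Qe′ refl → sep Pe Qe′ }

module _ (W : List (Bit × Point)) where

  letters : Word (length W)
  letters = V.map proj₁ (V.fromList W)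

  vertices : V.Vec Point (length W)
  vertices = V.map proj₂ (V.fromList W)

toList-letters : ∀ W → toList (letters W) ≡ word W
toList-letters []      = refl
toList-letters (e ∷ W) = cong (proj₁ e ∷_) (toList-letters W)

lookup-vertices-∈ : ∀ W i → V.lookup (vertices W) i ∈ points W
lookup-vertices-∈ (e ∷ W) fzero    = here refl
lookup-vertices-∈ (e ∷ W) (fsuc i) = there (lookup-vertices-∈ W i)

lookup-vertices-injective : ∀ W → Unique (points W) → ∀ i j →
  V.lookup (vertices W) i ≡ V.lookup (vertices W) j → i ≡ j
lookup-vertices-injective (e ∷ W) (_ ∷ u) fzero    fzero    _ = refl
lookup-vertices-injective (e ∷ W) (e∉ ∷ _) fzero    (fsuc j) eq =
  ⊥-elim (AllP.All¬⇒¬Any e∉ (subst (_∈ points W) (sym eq) (lookup-vertices-∈ W j)))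
lookup-vertices-injective (e ∷ W) (e∉ ∷ _) (fsuc i) fzero    eq =
  ⊥-elim (AllP.All¬⇒¬Any e∉ (subst (_∈ points W) eq (lookup-vertices-∈ W i)))
lookup-vertices-injective (e ∷ W) (_ ∷ u) (fsuc i) (fsuc j) eq =
  cong fsuc (lookup-vertices-injective W u i j eq)

walk-steps : ∀ {p W q} → Walk p W q → ∀ i j → toℕ j ≡ suc (toℕ i) →
             Adjacent (V.lookup (vertices W) i) (V.lookup (vertices W) j)
walk-steps (step a stop)       fzero    (fsuc fzero)     _  = adjacent a
walk-steps (step a (step _ _)) fzero    (fsuc fzero)     _  = adjacent a
walk-steps (step _ w)          (fsuc i) (fsuc j)         eq = walk-steps w i j (ℕP.suc-injective eq)
walk-steps (step _ (step _ _)) fzero    (fsuc (fsuc _)) ()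
walk-steps (step _ _)          (fsuc _) fzero           ()
walk-steps stop                fzero    fzero           ()

walk⇒fold : ∀ {p W q} → Walk p W q → SelfAvoiding W → Fold (letters W)
walk⇒fold {W = W} w sa = record
  { vertex   = vertices W
  ; distinct = lookup-vertices-injective W (AllPairsP.map⁺ (AllPairs.map _≉_.points-differ sa))
  ; steps    = walk-steps w
  }

occupiedByZero⇔∈ : ∀ {p W q} (w : Walk p W q) (sa : SelfAvoiding W) r →
                   OccupiedByZero (letters W) (walk⇒fold w sa) r ⇔ (b0 , r) ∈ W
occupiedByZero⇔∈ {W = W} _ _ r = mk⇔ (to W) (from W)
  where
  Zero-at : ∀ W → Set
  Zero-at W = ∃[ i ] (V.lookup (letters W) i ≡ b0 × V.lookup (vertices W) i ≡ r)

  to : ∀ W → Zero-at W → (b0 , r) ∈ W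
  to (_ ∷ _) (fzero , refl , refl) = here refl
  to (_ ∷ W) (fsuc i , eqs)        = there (to W (i , eqs))

  from : ∀ W → (b0 , r) ∈ W → Zero-at W
  from (_ ∷ _) (here refl) = fzero , refl , refl
  from (_ ∷ W) (there r∈W) with from W r∈W
  ... | i , eqs = fsuc i , eqs

-- Runs of zeros

-- c counts the zeros immediately preceding the list.
data ZeroRuns≤ (K : ℕ) : ℕ → List Bit → Set where
  []   : ∀ {c} → ZeroRuns≤ K c []
  _0∷_ : ∀ {c bs} → c < K → ZeroRuns≤ K (suc c) bs → ZeroRuns≤ K c (b0 ∷ bs)
  1∷_  : ∀ {c bs} → ZeroRuns≤ K 0 bs → ZeroRuns≤ K c (b1 ∷ bs)

zeroRuns≤-suffix : ∀ {K c} l {bs} → ZeroRuns≤ K c (l ++ bs) → ∃[ c′ ] ZeroRuns≤ K c′ bs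
zeroRuns≤-suffix []       rs        = _ , rs
zeroRuns≤-suffix (b0 ∷ l) (_ 0∷ rs) = zeroRuns≤-suffix l rs
zeroRuns≤-suffix (b1 ∷ l) (1∷ rs)   = zeroRuns≤-suffix l rs

zeroRuns≤-replicate : ∀ {K c} r {bs} → ZeroRuns≤ K c (replicate (suc r) b0 ++ bs) → r + c < K
zeroRuns≤-replicate zero            (c<K 0∷ _) = c<K
zeroRuns≤-replicate {K} {c} (suc r) (_ 0∷ rs) =
  subst (_< K) (ℕP.+-suc r c) (zeroRuns≤-replicate r rs)

zeroRuns≤⇒¬Factor : ∀ {K bs} → ZeroRuns≤ K 0 bs → ¬ Factor (replicate (suc K) b0) bs
zeroRuns≤⇒¬Factor {K} rs (l , r , refl) with zeroRuns≤-suffix l rs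
... | c , rs′ = ℕP.<-irrefl refl (ℕP.≤-trans (s≤s (ℕP.m≤m+n K c)) (zeroRuns≤-replicate K rs′))

record ShortRuns (K : ℕ) (W : List (Bit × Point)) : Set where
  constructor mkShortRuns
  field prepend : ∀ {R} → ZeroRuns≤ K 0 (word R) → ZeroRuns≤ K 0 (word (W ++ R))
open ShortRuns

shortRuns⇒zeroRuns≤ : ∀ {K W} → ShortRuns K W → ZeroRuns≤ K 0 (word W)
shortRuns⇒zeroRuns≤ {K} {W} h = subst (ZeroRuns≤ K 0 ∘ word) (LP.++-identityʳ W) (prepend h [])

shortRuns⇒¬Factor : ∀ {K W} → ShortRuns K W → ¬ Factor (replicate (K + 1) b0) (toList (letters W))
shortRuns⇒¬Factor {K} {W} h factor = zeroRuns≤⇒¬Factor (shortRuns⇒zeroRuns≤ h)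
  (subst₂ (λ m bs → Factor (replicate m b0) bs) (ℕP.+-comm K 1) (toList-letters W) factor)

shortRuns-one : ∀ {K p W} → ShortRuns K W → ShortRuns K ((b1 , p) ∷ W)
shortRuns-one h = mkShortRuns λ rs → 1∷ prepend h rs

shortRuns-ones : ∀ {K W} → All (λ e → proj₁ e ≡ b1) W → ShortRuns K W
shortRuns-ones []         = mkShortRuns λ rs → rs
shortRuns-ones (refl ∷ o) = shortRuns-one (shortRuns-ones o)

shortRuns-++ : ∀ {K} W {V} → ShortRuns K W → ShortRuns K V → ShortRuns K (W ++ V)
shortRuns-++ {K} W {V} hW hV = mkShortRuns λ {R} rs →
  subst (ZeroRuns≤ K 0 ∘ word) (sym (LP.++-assoc W V R)) (prepend hW (prepend hV rs))

zeroRuns≤-zeros : ∀ {K c p T} Z → All (λ e → proj₁ e ≡ b0) Z → c + length Z ≤ K →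
                  ZeroRuns≤ K 0 (word T) → ZeroRuns≤ K c (word (Z ++ (b1 , p) ∷ T))
zeroRuns≤-zeros []      []         _  rs = 1∷ rs
zeroRuns≤-zeros {K} {c} (_ ∷ Z) (refl ∷ z) le rs =
  ℕP.<-≤-trans (ℕP.m<m+n c (s≤s z≤n)) le
  0∷ zeroRuns≤-zeros Z z (subst (_≤ K) (ℕP.+-suc c (length Z)) le) rs

shortRuns-zeros : ∀ {K p V} Z → All (λ e → proj₁ e ≡ b0) Z → length Z ≤ K →
                  ShortRuns K V → ShortRuns K (Z ++ (b1 , p) ∷ V)
shortRuns-zeros {K} {p} {V} Z z le hV = mkShortRuns λ {R} rs →
  subst (ZeroRuns≤ K 0 ∘ word) (sym (LP.++-assoc Z ((b1 , p) ∷ V) R)) (zeroRuns≤-zeros Z z le (prepend hV rs))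

shortRuns-map : ∀ {K} f W → ShortRuns K W → ShortRuns K (mapPoints f W)
shortRuns-map {K} f W h = mkShortRuns λ {R} rs → subst (ZeroRuns≤ K 0) (sym (word-map R W)) (prepend h rs)
  where
  word-map : ∀ R W → word (mapPoints f W ++ R) ≡ word (W ++ R)
  word-map R []      = refl
  word-map R (e ∷ W) = cong (proj₁ e ∷_) (word-map R W)

shortRuns-concat : ∀ {K Ws} → All (ShortRuns K) Ws → ShortRuns K (L.concat Ws)
shortRuns-concat []                 = mkShortRuns λ rs → rs
shortRuns-concat {Ws = W ∷ _} (h ∷ hs) = shortRuns-++ W h (shortRuns-concat hs)

ascending descending : Bit → (ℕ → Point) → ℕ → List (Bit × Point)
ascending  b g = applyUpTo     (λ t → b , g t)
descending b g = applyDownFrom (λ t → b , g t)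

walk-ascending : ∀ {b} g → (∀ t → g t ∼ g (suc t)) → ∀ n → Walk (g 0) (ascending b g (suc n)) (g n)
walk-ascending g g∼ zero    = stop
walk-ascending g g∼ (suc n) = step (g∼ 0) (walk-ascending (g ∘ suc) (g∼ ∘ suc) n)

walk-descending : ∀ {b} g → (∀ t → g t ∼ g (suc t)) → ∀ n → Walk (g n) (descending b g (suc n)) (g 0)
walk-descending g g∼ zero    = stop
walk-descending g g∼ (suc n) = step (∼-sym (g∼ n)) (walk-descending g g∼ n)

selfAvoiding-ascending : ∀ {b} g → Injective _≡_ _≡_ g → ∀ n → SelfAvoiding (ascending b g n)
selfAvoiding-ascending {b} g inj n =
  AllPairsP.applyUpTo⁺₁ (λ t → b , g t) n (λ i<j _ → distinct (ℕP.<⇒≢ i<j ∘ inj))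

selfAvoiding-descending : ∀ {b} g → Injective _≡_ _≡_ g → ∀ n → SelfAvoiding (descending b g n)
selfAvoiding-descending {b} g inj n =
  AllPairsP.applyDownFrom⁺₁ (λ t → b , g t) n (λ j<i _ → distinct (ℕP.<⇒≢ j<i ∘ sym ∘ inj))

all-ascending : ∀ {P : Bit × Point → Set} {b} g n → (∀ {t} → t < n → P (b , g t)) →
                All P (ascending b g n)
all-ascending {b = b} g n = AllP.applyUpTo⁺₁ (λ t → b , g t) n

all-descending : ∀ {P : Bit × Point → Set} {b} g n → (∀ {t} → t < n → P (b , g t)) →
                 All P (descending b g n)
all-descending {b = b} g n = AllP.applyDownFrom⁺₁ (λ t → b , g t) n

∈-ascending : ∀ {b} g {t n} → t < n → (b , g t) ∈ ascending b g n
∈-ascending g t<n = AnyP.applyUpTo⁺ _ refl t<n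

∈-descending : ∀ {b} g {t n} → t < n → (b , g t) ∈ descending b g n
∈-descending g t<n = AnyP.applyDownFrom⁺ _ refl t<n

column : ℤ → ℕ → Point
column x t = x , + t

row : ℤ → ℕ → Point
row y i = + i , y

column-injective : ∀ x → Injective _≡_ _≡_ (column x)
column-injective x = ℤP.+-injective ∘ ,-injectiveʳ

row-injective : ∀ y → Injective _≡_ _≡_ (row y)
row-injective y = ℤP.+-injective ∘ ,-injectiveˡ

column-∼ : ∀ x t → column x t ∼ column x (suc t)
column-∼ x t = ∼-up x (+ t)

row-∼ : ∀ y i → row y i ∼ row y (suc i)
row-∼ y i = ∼-right (+ i) y

data OnColumn (x : ℤ) : Bit × Point → Set where
  on : ∀ {b y} → OnColumn x (b , (x , y))

data LeftOfColumn (x : ℤ) : Bit × Point → Set where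
  left-of : ∀ {b x′ y} → x′ ℤ.< x → LeftOfColumn x (b , (x′ , y))

column-apart : ∀ x → Apart (OnColumn x) (LeftOfColumn x)
column-apart x on (left-of x′<x) refl = ℤP.<-irrefl refl x′<x

-2ℤ : ℤ
-2ℤ = -[1+ 1 ]

-- A corner block of nested hooks

-- The block [0, k] × [0, k + s]; every walk through it ends at (-2, a + s).
module Block (s a : ℕ) where

  hookUp hookDown : ℕ → List (Bit × Point)
  hookUp   m = ascending b0 (column (+ m)) (suc (m + s)) ++ descending b0 (row (+ (m + s))) m
  hookDown m = ascending b0 (row (+ (m + s))) m ++ descending b0 (column (+ m)) (suc (m + s))

  data OnShell (m : ℕ) : Bit × Point → Set where
    side : ∀ {t} → t ≤ m + s → OnShell m (b0 , (+ m , + t))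
    top  : ∀ {i} → i < m → OnShell m (b0 , (+ i , + (m + s)))

  hookUp-onShell : ∀ m → All (OnShell m) (hookUp m)
  hookUp-onShell m = AllP.++⁺ (all-ascending (column (+ m)) (suc (m + s)) (side ∘ ℕP.≤-pred))
                              (all-descending (row (+ (m + s))) m top)

  hookDown-onShell : ∀ m → All (OnShell m) (hookDown m)
  hookDown-onShell m = AllP.++⁺ (all-ascending (row (+ (m + s))) m top)
                                (all-descending (column (+ m)) (suc (m + s)) (side ∘ ℕP.≤-pred))

  onShell-∈-hookUp : ∀ {m e} → OnShell m e → e ∈ hookUp m
  onShell-∈-hookUp {m} (side t≤) = ∈-++⁺ˡ (∈-ascending (column (+ m)) (s≤s t≤))
  onShell-∈-hookUp {m} (top i<m) = ∈-++⁺ʳ _ (∈-descending (row (+ (m + s))) i<m)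

  onShell-∈-hookDown : ∀ {m e} → OnShell m e → e ∈ hookDown m
  onShell-∈-hookDown {m} (side t≤) = ∈-++⁺ʳ _ (∈-descending (column (+ m)) (s≤s t≤))
  onShell-∈-hookDown {m} (top i<m) = ∈-++⁺ˡ (∈-ascending (row (+ (m + s))) i<m)

  selfAvoiding-hookUp : ∀ m → SelfAvoiding (hookUp m)
  selfAvoiding-hookUp m =
    selfAvoiding-++ {P = OnColumn (+ m)} {Q = LeftOfColumn (+ m)}
      (all-ascending (column (+ m)) (suc (m + s)) (λ _ → on))
      (all-descending (row (+ (m + s))) m (left-of ∘ ℤ.+<+))
      (column-apart (+ m))
      (selfAvoiding-ascending {b0} (column (+ m)) (column-injective (+ m)) (suc (m + s)))
      (selfAvoiding-descending {b0} (row (+ (m + s))) (row-injective (+ (m + s))) m)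

  selfAvoiding-hookDown : ∀ m → SelfAvoiding (hookDown m)
  selfAvoiding-hookDown m =
    selfAvoiding-++ {P = LeftOfColumn (+ m)} {Q = OnColumn (+ m)}
      (all-ascending (row (+ (m + s))) m (left-of ∘ ℤ.+<+))
      (all-descending (column (+ m)) (suc (m + s)) (λ _ → on))
      (λ x<m x≡m eq → column-apart (+ m) x≡m x<m (sym eq))
      (selfAvoiding-ascending {b0} (row (+ (m + s))) (row-injective (+ (m + s))) m)
      (selfAvoiding-descending {b0} (column (+ m)) (column-injective (+ m)) (suc (m + s)))

  length-hookUp : ∀ m → length (hookUp m) ≡ suc (m + s) + m
  length-hookUp m = trans (LP.length-++ (ascending b0 (column (+ m)) (suc (m + s))))
    (cong₂ _+_ (LP.length-applyUpTo (λ t → b0 , column (+ m) t) (suc (m + s)))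
               (LP.length-applyDownFrom (λ i → b0 , row (+ (m + s)) i) m))

  length-hookDown : ∀ m → length (hookDown m) ≡ suc (m + s) + m
  length-hookDown m = trans (LP.length-++ (ascending b0 (row (+ (m + s))) m))
    (trans (cong₂ _+_ (LP.length-applyUpTo (λ i → b0 , row (+ (m + s)) i) m)
                      (LP.length-applyDownFrom (λ t → b0 , column (+ m) t) (suc (m + s))))
           (ℕP.+-comm m (suc (m + s))))

  walk-hookUp : ∀ m → Walk (+ m , + 0) (hookUp m) (+ 0 , + (m + s))
  walk-hookUp zero    = walk-++-[] (walk-ascending (column (+ 0)) (column-∼ (+ 0)) s)
  walk-hookUp (suc m) = walk-++ (walk-ascending (column (+ suc m)) (column-∼ (+ suc m)) (suc m + s))
                          (∼-left (+ m) (+ (suc m + s)))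
                          (walk-descending (row (+ (suc m + s))) (row-∼ (+ (suc m + s))) m)

  walk-hookDown : ∀ m → Walk (+ 0 , + (m + s)) (hookDown m) (+ m , + 0)
  walk-hookDown zero    = walk-descending (column (+ 0)) (column-∼ (+ 0)) s
  walk-hookDown (suc m) = walk-++ (walk-ascending (row (+ (suc m + s))) (row-∼ (+ (suc m + s))) m)
                            (∼-right (+ m) (+ (suc m + s)))
                            (walk-descending (column (+ suc m)) (column-∼ (+ suc m)) (suc m + s))

  rising : ℕ → Point
  rising t = -2ℤ , + (t + s)

  exitUp exitDown : List (Bit × Point)
  exitUp   = (b1 , (-1ℤ , + s)) ∷ ascending b1 rising (suc a)
  exitDown = (b1 , (0ℤ , -1ℤ)) ∷ (b1 , (-1ℤ , -1ℤ)) ∷ (b1 , (-2ℤ , -1ℤ)) ∷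
             ascending b1 (column -2ℤ) (suc (a + s))

  leftLink bottomLink : ℕ → List (Bit × Point) → List (Bit × Point)
  leftLink   m W = (b1 , (-1ℤ , + (suc m + s))) ∷ (b1 , (-1ℤ , + (m + s))) ∷ W
  bottomLink m W = (b1 , (+ suc m , -1ℤ)) ∷ (b1 , (+ m , -1ℤ)) ∷ W

  up down : ℕ → List (Bit × Point)
  up   zero    = hookUp 0 ++ exitUp
  up   (suc m) = hookUp (suc m) ++ leftLink m (down m)
  down zero    = hookDown 0 ++ exitDown
  down (suc m) = hookDown (suc m) ++ bottomLink m (up m)

  block : ℕ → List (Bit × Point)
  block k = (b1 , (+ k , -2ℤ)) ∷ (b1 , (+ k , -1ℤ)) ∷ up k

  exit : Point
  exit = -2ℤ , + (a + s)

  walk-exitUp : Walk (-1ℤ , + s) exitUp exit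
  walk-exitUp = step (∼-left -2ℤ (+ s)) (walk-ascending rising (λ t → ∼-up -2ℤ (+ (t + s))) a)

  walk-exitDown : Walk (0ℤ , -1ℤ) exitDown exit
  walk-exitDown = step (∼-left -1ℤ -1ℤ) (step (∼-left -2ℤ -1ℤ) (step (∼-up -2ℤ -1ℤ)
                    (walk-ascending (column -2ℤ) (column-∼ -2ℤ) (a + s))))

  walk-up   : ∀ m → Walk (+ m , + 0) (up m) exit
  walk-down : ∀ m → Walk (+ 0 , + (m + s)) (down m) exit
  walk-up zero       = walk-++ (walk-hookUp 0) (∼-left -1ℤ (+ s)) walk-exitUp
  walk-up (suc m)    = walk-++ (walk-hookUp (suc m)) (∼-left -1ℤ (+ (suc m + s)))
                         (step (∼-down -1ℤ (+ (m + s))) (step (∼-right -1ℤ (+ (m + s))) (walk-down m)))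
  walk-down zero     = walk-++ (walk-hookDown 0) (∼-down (+ 0) -1ℤ) walk-exitDown
  walk-down (suc m)  = walk-++ (walk-hookDown (suc m)) (∼-down (+ suc m) -1ℤ)
                         (step (∼-left (+ m) -1ℤ) (step (∼-up (+ m) -1ℤ) (walk-up m)))

  walk-block : ∀ k → Walk (+ k , -2ℤ) (block k) exit
  walk-block k = step (∼-up (+ k) -2ℤ) (step (∼-up (+ k) -1ℤ) (walk-up k))

  data Box (M : ℕ) : Bit × Point → Set where
    box : ∀ {i t} → i ≤ M → t ≤ M + s → Box M (b0 , (+ i , + t))

  data Border (B L : ℕ) : Bit × Point → Set where
    bottom-row  : ∀ {i} → i < B → Border B L (b1 , (+ i , -1ℤ))
    left-column : ∀ {t} → t < L → Border B L (b1 , (-1ℤ , + t))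
    corner      : Border B L (b1 , (-1ℤ , -1ℤ))
    exit-column : ∀ {y} → y ℤ.≤ + (a + s) → Border B L (b1 , (-2ℤ , y))

  Region : ℕ → ℕ → ℕ → Bit × Point → Set
  Region B L M e = Box M e ⊎ Border B L e

  UpRegion DownRegion : ℕ → Bit × Point → Set
  UpRegion   M = Region M (suc (M + s)) M
  DownRegion M = Region (suc M) (M + s) M

  region-mono : ∀ {B B′ L L′ M M′ e} → B ≤ B′ → L ≤ L′ → M ≤ M′ →
                Region B L M e → Region B′ L′ M′ e
  region-mono _  _  M≤ (inj₁ (box i≤ t≤))      =
    inj₁ (box (ℕP.≤-trans i≤ M≤) (ℕP.≤-trans t≤ (ℕP.+-monoˡ-≤ s M≤)))
  region-mono B≤ _  _  (inj₂ (bottom-row i<))  = inj₂ (bottom-row (ℕP.<-≤-trans i< B≤))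
  region-mono _  L≤ _  (inj₂ (left-column t<)) = inj₂ (left-column (ℕP.<-≤-trans t< L≤))
  region-mono _  _  _  (inj₂ corner)           = inj₂ corner
  region-mono _  _  _  (inj₂ (exit-column y≤)) = inj₂ (exit-column y≤)

  onShell⇒box : ∀ {m e} → OnShell m e → Box m e
  onShell⇒box (side t≤) = box ℕP.≤-refl t≤
  onShell⇒box (top i<m) = box (ℕP.<⇒≤ i<m) ℕP.≤-refl

  box-apart-border : ∀ {M B L} → Apart (Box M) (Border B L)
  box-apart-border (box _ _) (bottom-row _)  ()
  box-apart-border (box _ _) (left-column _) ()
  box-apart-border (box _ _) corner          ()
  box-apart-border (box _ _) (exit-column _) ()

  onShell-apart-border : ∀ {m B L} → Apart (OnShell m) (Border B L)
  onShell-apart-border = box-apart-border ∘ onShell⇒box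

  onShell-apart-box : ∀ {m} → Apart (OnShell (suc m)) (Box m)
  onShell-apart-box (side _) (box i≤m _) refl = ℕP.<-irrefl refl i≤m
  onShell-apart-box (top _)  (box _ t≤)  refl = ℕP.<-irrefl refl t≤

  onShell-apart-region : ∀ {m B L} → Apart (OnShell (suc m)) (Region B L m)
  onShell-apart-region sh (inj₁ bx) = onShell-apart-box sh bx
  onShell-apart-region sh (inj₂ bd) = onShell-apart-border sh bd

  exitUp-border : ∀ {B} → All (Border B (suc s)) exitUp
  exitUp-border = left-column ℕP.≤-refl ∷
    all-ascending rising (suc a) (λ t<1+a → exit-column (ℤ.+≤+ (ℕP.+-monoˡ-≤ s (ℕP.≤-pred t<1+a))))

  exitDown-border : ∀ {B L} → All (Border (suc B) L) exitDown
  exitDown-border = bottom-row (s≤s z≤n) ∷ corner ∷ exit-column ℤ.-≤+ ∷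
    all-ascending (column -2ℤ) (suc (a + s)) (λ t<1+a+s → exit-column (ℤ.+≤+ (ℕP.≤-pred t<1+a+s)))

  hookUp-region : ∀ m {B L} → All (Region B L m) (hookUp m)
  hookUp-region m = All.map (inj₁ ∘ onShell⇒box) (hookUp-onShell m)

  hookDown-region : ∀ m {B L} → All (Region B L m) (hookDown m)
  hookDown-region m = All.map (inj₁ ∘ onShell⇒box) (hookDown-onShell m)

  leftLink-region : ∀ m {W} → All (DownRegion m) W → All (Region (suc m) (suc (suc m + s)) m) (leftLink m W)
  leftLink-region m R =
    inj₂ (left-column ℕP.≤-refl) ∷ inj₂ (left-column (ℕP.m<n⇒m<1+n (ℕP.n<1+n _))) ∷
    All.map (region-mono ℕP.≤-refl (ℕP.m≤n⇒m≤1+n (ℕP.n≤1+n _)) ℕP.≤-refl) R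

  bottomLink-region : ∀ m {W} → All (UpRegion m) W → All (Region (suc (suc m)) (suc m + s) m) (bottomLink m W)
  bottomLink-region m R =
    inj₂ (bottom-row ℕP.≤-refl) ∷ inj₂ (bottom-row (ℕP.m<n⇒m<1+n (ℕP.n<1+n _))) ∷
    All.map (region-mono (ℕP.m≤n⇒m≤1+n (ℕP.n≤1+n _)) ℕP.≤-refl ℕP.≤-refl) R

  up-region   : ∀ M → All (UpRegion M) (up M)
  down-region : ∀ M → All (DownRegion M) (down M)
  up-region zero      = AllP.++⁺ (hookUp-region 0) (All.map inj₂ exitUp-border)
  up-region (suc m)   = AllP.++⁺ (hookUp-region (suc m))
    (All.map (region-mono ℕP.≤-refl ℕP.≤-refl (ℕP.n≤1+n m)) (leftLink-region m (down-region m)))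
  down-region zero    = AllP.++⁺ (hookDown-region 0) (All.map inj₂ exitDown-border)
  down-region (suc m) = AllP.++⁺ (hookDown-region (suc m))
    (All.map (region-mono ℕP.≤-refl ℕP.≤-refl (ℕP.n≤1+n m)) (bottomLink-region m (up-region m)))

  selfAvoiding-exitUp : SelfAvoiding exitUp
  selfAvoiding-exitUp = all-ascending rising (suc a) (λ _ → distinct λ ()) ∷
    selfAvoiding-ascending rising (ℕP.+-cancelʳ-≡ s _ _ ∘ ℤP.+-injective ∘ ,-injectiveʳ) (suc a)

  selfAvoiding-exitDown : SelfAvoiding exitDown
  selfAvoiding-exitDown =
    (distinct (λ ()) ∷ distinct (λ ()) ∷ all-ascending (column -2ℤ) _ (λ _ → distinct λ ())) ∷
    (distinct (λ ()) ∷ all-ascending (column -2ℤ) _ (λ _ → distinct λ ())) ∷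
    all-ascending (column -2ℤ) _ (λ _ → distinct λ ()) ∷
    selfAvoiding-ascending (column -2ℤ) (column-injective -2ℤ) (suc (a + s))

  selfAvoiding-leftLink : ∀ m {W} → All (DownRegion m) W → SelfAvoiding W → SelfAvoiding (leftLink m W)
  selfAvoiding-leftLink m R sW =
    (distinct (ℕP.1+n≢n ∘ ℤP.+-injective ∘ ,-injectiveʳ) ∷
     avoids (λ { (inj₁ ()) ; (inj₂ (left-column t<)) → ℕP.<-asym (ℕP.n<1+n _) t< }) R) ∷
    avoids (λ { (inj₁ ()) ; (inj₂ (left-column t<)) → ℕP.<-irrefl refl t< }) R ∷ sW

  selfAvoiding-bottomLink : ∀ m {W} → All (UpRegion m) W → SelfAvoiding W → SelfAvoiding (bottomLink m W)
  selfAvoiding-bottomLink m R sW =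
    (distinct (ℕP.1+n≢n ∘ ℤP.+-injective ∘ ,-injectiveˡ) ∷
     avoids (λ { (inj₁ ()) ; (inj₂ (bottom-row i<)) → ℕP.<-asym (ℕP.n<1+n _) i< }) R) ∷
    avoids (λ { (inj₁ ()) ; (inj₂ (bottom-row i<)) → ℕP.<-irrefl refl i< }) R ∷ sW

  selfAvoiding-up   : ∀ M → SelfAvoiding (up M)
  selfAvoiding-down : ∀ M → SelfAvoiding (down M)
  selfAvoiding-up zero =
    selfAvoiding-++ (hookUp-onShell 0) (exitUp-border {0}) onShell-apart-border
      (selfAvoiding-hookUp 0) selfAvoiding-exitUp
  selfAvoiding-up (suc m) =
    selfAvoiding-++ (hookUp-onShell (suc m)) (leftLink-region m (down-region m)) onShell-apart-region
      (selfAvoiding-hookUp (suc m)) (selfAvoiding-leftLink m (down-region m) (selfAvoiding-down m))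
  selfAvoiding-down zero =
    selfAvoiding-++ (hookDown-onShell 0) (exitDown-border {0} {0}) onShell-apart-border
      (selfAvoiding-hookDown 0) selfAvoiding-exitDown
  selfAvoiding-down (suc m) =
    selfAvoiding-++ (hookDown-onShell (suc m)) (bottomLink-region m (up-region m)) onShell-apart-region
      (selfAvoiding-hookDown (suc m)) (selfAvoiding-bottomLink m (up-region m) (selfAvoiding-up m))

  selfAvoiding-block : ∀ k → SelfAvoiding (block k)
  selfAvoiding-block k =
    (distinct (λ ()) ∷ avoids (λ { (inj₁ ()) ; (inj₂ ()) }) (up-region k)) ∷
    avoids (λ { (inj₁ ()) ; (inj₂ (bottom-row k<k)) → ℕP.<-irrefl refl k<k }) (up-region k) ∷
    selfAvoiding-up k

  Bounded : ℕ → Point → Set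
  Bounded k (x , y) = x ℤ.≤ + k × y ℤ.≤ + (k + s)

  block-bounded : ∀ k → a ≤ k → All (Bounded k ∘ proj₂) (block k)
  block-bounded k a≤k = (ℤP.≤-refl , ℤ.-≤+) ∷ (ℤP.≤-refl , ℤ.-≤+) ∷ All.map bounded (up-region k)
    where
    bounded : ∀ {e} → UpRegion k e → Bounded k (proj₂ e)
    bounded (inj₁ (box i≤ t≤))          = ℤ.+≤+ i≤ , ℤ.+≤+ t≤
    bounded (inj₂ (bottom-row i<))      = ℤ.+≤+ (ℕP.<⇒≤ i<) , ℤ.-≤+
    bounded (inj₂ (left-column t<))     = ℤ.-≤+ , ℤ.+≤+ (ℕP.≤-pred t<)
    bounded (inj₂ corner)               = ℤ.-≤+ , ℤ.-≤+
    bounded (inj₂ (exit-column y≤))     = ℤ.-≤+ , ℤP.≤-trans y≤ (ℤ.+≤+ (ℕP.+-monoˡ-≤ s a≤k))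

  zero∈block⇒box : ∀ {k p} → (b0 , p) ∈ block k → Box k (b0 , p)
  zero∈block⇒box {k} (there (there z∈up)) with All.lookup (up-region k) z∈up
  ... | inj₁ bx = bx

  box-split : ∀ {m e} → Box (suc m) e → OnShell (suc m) e ⊎ Box m e
  box-split {m} (box {i} {t} i≤ t≤) with i ℕP.≟ suc m
  ... | yes refl = inj₁ (side t≤)
  ... | no i≢ with t ℕP.≟ suc m + s
  ...   | yes refl = inj₁ (top (ℕP.≤∧≢⇒< i≤ i≢))
  ...   | no t≢    = inj₂ (box (ℕP.≤-pred (ℕP.≤∧≢⇒< i≤ i≢)) (ℕP.≤-pred (ℕP.≤∧≢⇒< t≤ t≢)))

  box∈up   : ∀ M {e} → Box M e → e ∈ up M
  box∈down : ∀ M {e} → Box M e → e ∈ down M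
  box∈up zero (box z≤n t≤) = ∈-++⁺ˡ (onShell-∈-hookUp (side t≤))
  box∈up (suc m) bx with box-split bx
  ... | inj₁ sh  = ∈-++⁺ˡ (onShell-∈-hookUp sh)
  ... | inj₂ bx′ = ∈-++⁺ʳ (hookUp (suc m)) (there (there (box∈down m bx′)))
  box∈down zero (box z≤n t≤) = ∈-++⁺ˡ (onShell-∈-hookDown (side t≤))
  box∈down (suc m) bx with box-split bx
  ... | inj₁ sh  = ∈-++⁺ˡ (onShell-∈-hookDown sh)
  ... | inj₂ bx′ = ∈-++⁺ʳ (hookDown (suc m)) (there (there (box∈up m bx′)))

  box∈block : ∀ k {e} → Box k e → e ∈ block k
  box∈block k bx = there (there (box∈up k bx))

  onShell⇒zero : ∀ {m e} → OnShell m e → proj₁ e ≡ b0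
  onShell⇒zero (side _) = refl
  onShell⇒zero (top _)  = refl

  hook-length-mono : ∀ m → suc (m + s) + m ≤ suc (suc m + s) + suc m
  hook-length-mono m = ℕP.+-mono-≤ (ℕP.n≤1+n _) (ℕP.n≤1+n m)

  shortRuns-up   : ∀ {K} M → suc (M + s) + M ≤ K → ShortRuns K (up M)
  shortRuns-down : ∀ {K} M → suc (M + s) + M ≤ K → ShortRuns K (down M)
  shortRuns-up {K} zero h =
    shortRuns-zeros (hookUp 0) (All.map onShell⇒zero (hookUp-onShell 0))
      (subst (_≤ K) (sym (length-hookUp 0)) h) (shortRuns-ones (all-ascending rising (suc a) (λ _ → refl)))
  shortRuns-up {K} (suc m) h =
    shortRuns-zeros (hookUp (suc m)) (All.map onShell⇒zero (hookUp-onShell (suc m)))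
      (subst (_≤ K) (sym (length-hookUp (suc m))) h)
      (shortRuns-one (shortRuns-down m (ℕP.≤-trans (hook-length-mono m) h)))
  shortRuns-down {K} zero h =
    shortRuns-zeros (hookDown 0) (All.map onShell⇒zero (hookDown-onShell 0))
      (subst (_≤ K) (sym (length-hookDown 0)) h)
      (shortRuns-ones (refl ∷ refl ∷ all-ascending (column -2ℤ) (suc (a + s)) (λ _ → refl)))
  shortRuns-down {K} (suc m) h =
    shortRuns-zeros (hookDown (suc m)) (All.map onShell⇒zero (hookDown-onShell (suc m)))
      (subst (_≤ K) (sym (length-hookDown (suc m))) h)
      (shortRuns-one (shortRuns-up m (ℕP.≤-trans (hook-length-mono m) h)))

  shortRuns-block : ∀ {K} k → suc (k + s) + k ≤ K → ShortRuns K (block k)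
  shortRuns-block k h = shortRuns-one (shortRuns-one (shortRuns-up k h))

-- Quarter turns and the assembled square

c-[c-i]≡i : ∀ c i → c ℤ.- (c ℤ.- i) ≡ i
c-[c-i]≡i = solve-∀

[c-i]-[c-j]≡j-i : ∀ c i j → (c ℤ.- i) ℤ.- (c ℤ.- j) ≡ j ℤ.- i
[c-i]-[c-j]≡j-i = solve-∀

module Rotation (c : ℤ) where

  ρ₁ ρ₂ ρ₃ : Point → Point
  ρ₁ (x , y) = c ℤ.- y , x
  ρ₂ (x , y) = c ℤ.- x , c ℤ.- y
  ρ₃ (x , y) = y , c ℤ.- x

  ∣[c-i]-[c-j]∣≡∣i-j∣ : ∀ i j → ∣ (c ℤ.- i) ℤ.- (c ℤ.- j) ∣ ≡ ∣ i ℤ.- j ∣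
  ∣[c-i]-[c-j]∣≡∣i-j∣ i j = trans (cong ∣_∣ ([c-i]-[c-j]≡j-i c i j)) (ℤP.∣i-j∣≡∣j-i∣ j i)

  c-injective : ∀ {i j} → c ℤ.- i ≡ c ℤ.- j → i ≡ j
  c-injective {i} {j} eq = trans (sym (c-[c-i]≡i c i)) (trans (cong (λ z → c ℤ.- z) eq) (c-[c-i]≡i c j))

  ρ₁-∼ : ∀ {p q} → p ∼ q → ρ₁ p ∼ ρ₁ q
  ρ₁-∼ {x , y} {x′ , y′} (adj e) = adj (trans
    (cong (λ n → n + ∣ x ℤ.- x′ ∣) (∣[c-i]-[c-j]∣≡∣i-j∣ y y′)) (trans (ℕP.+-comm ∣ y ℤ.- y′ ∣ _) e))

  ρ₂-∼ : ∀ {p q} → p ∼ q → ρ₂ p ∼ ρ₂ q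
  ρ₂-∼ {x , y} {x′ , y′} (adj e) = adj (trans
    (cong₂ _+_ (∣[c-i]-[c-j]∣≡∣i-j∣ x x′) (∣[c-i]-[c-j]∣≡∣i-j∣ y y′)) e)

  ρ₃-∼ : ∀ {p q} → p ∼ q → ρ₃ p ∼ ρ₃ q
  ρ₃-∼ {x , y} {x′ , y′} (adj e) = adj (trans
    (cong (λ n → ∣ y ℤ.- y′ ∣ + n) (∣[c-i]-[c-j]∣≡∣i-j∣ x x′)) (trans (ℕP.+-comm ∣ y ℤ.- y′ ∣ _) e))

  ρ₁-injective : ∀ {p q} → ρ₁ p ≡ ρ₁ q → p ≡ q
  ρ₁-injective {_ , _} {_ , _} eq = cong₂ _,_ (,-injectiveʳ eq) (c-injective (,-injectiveˡ eq))

  ρ₂-injective : ∀ {p q} → ρ₂ p ≡ ρ₂ q → p ≡ q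
  ρ₂-injective {_ , _} {_ , _} eq = cong₂ _,_ (c-injective (,-injectiveˡ eq)) (c-injective (,-injectiveʳ eq))

  ρ₃-injective : ∀ {p q} → ρ₃ p ≡ ρ₃ q → p ≡ q
  ρ₃-injective {_ , _} {_ , _} eq = cong₂ _,_ (c-injective (,-injectiveʳ eq)) (,-injectiveˡ eq)

gap : ∀ {x m n} → x ℤ.≤ + m → + n ℤ.≤ x → m < n → ⊥
gap x≤m n≤x m<n with ℤP.≤-trans n≤x x≤m
... | ℤ.+≤+ n≤m = ℕP.<⇒≱ m<n n≤m

module Assembly (k : ℕ) where

  N : ℕ
  N = suc k

  c : ℤ
  c = + (2 * N)

  open Rotation c

  module B₁ = Block 1 k
  module B₀ = Block 0 0

  halfRow : List (Bit × Point)
  halfRow = descending b0 (row (+ N)) (suc N) ++ (b1 , (-1ℤ , + N)) ∷ (b1 , (-2ℤ , + N)) ∷ []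

  parts : List (List (Bit × Point))
  parts = halfRow ∷ mapPoints ρ₃ (B₁.block k) ∷ mapPoints ρ₂ (B₁.block k) ∷
          mapPoints ρ₁ (B₁.block k) ∷ B₀.block k ∷ []

  W : List (Bit × Point)
  W = L.concat parts

  k+1≡N : k + 1 ≡ N
  k+1≡N = ℕP.+-comm k 1

  2N≡k+[1+N] : 2 * N ≡ k + suc N
  2N≡k+[1+N] = eq k
    where eq : ∀ k → 2 * suc k ≡ k + suc (suc k)
          eq = ℕSolver.solve-∀

  2N∸N≡N : 2 * N ∸ N ≡ N
  2N∸N≡N = trans (cong (λ n → N + n ∸ N) (ℕP.+-identityʳ N)) (ℕP.m+n∸m≡n N N)

  2N∸k≡1+N : 2 * N ∸ k ≡ suc N
  2N∸k≡1+N = trans (cong (_∸ k) 2N≡k+[1+N]) (ℕP.m+n∸m≡n k (suc N))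

  2N∸[1+N]≡k : 2 * N ∸ suc N ≡ k
  2N∸[1+N]≡k = trans (cong (_∸ suc N) 2N≡k+[1+N]) (ℕP.m+n∸n≡m k (suc N))

  1+N≤2N : suc N ≤ 2 * N
  1+N≤2N = subst (suc N ≤_) (trans (ℕP.+-comm (suc N) k) (sym 2N≡k+[1+N])) (ℕP.m≤m+n (suc N) k)

  N≤2N : N ≤ 2 * N
  N≤2N = ℕP.<⇒≤ 1+N≤2N

  c-+≡ : ∀ {t} → t ≤ 2 * N → c ℤ.- + t ≡ + (2 * N ∸ t)
  c-+≡ {t} t≤ = trans (ℤP.m-n≡m⊖n (2 * N) t) (ℤP.⊖-≥ t≤)

  c-[2N∸x]≡x : ∀ {x} → x ≤ 2 * N → c ℤ.- + (2 * N ∸ x) ≡ + x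
  c-[2N∸x]≡x {x} x≤ = trans (c-+≡ (ℕP.m∸n≤m (2 * N) x)) (cong +_ (ℕP.m∸[m∸n]≡n x≤))

  c-k≡1+N : c ℤ.- + k ≡ + suc N
  c-k≡1+N = trans (c-+≡ (ℕP.≤-trans (ℕP.n≤1+n k) N≤2N)) (cong +_ 2N∸k≡1+N)

  c-[k+1]≡N : c ℤ.- + (k + 1) ≡ + N
  c-[k+1]≡N = trans (cong (λ n → c ℤ.- + n) k+1≡N) (trans (c-+≡ N≤2N) (cong +_ 2N∸N≡N))

  reflect-≤ : ∀ {x m} → x ℤ.≤ + m → c ℤ.- + m ℤ.≤ c ℤ.- x
  reflect-≤ x≤m = ℤP.+-monoʳ-≤ c (ℤP.neg-mono-≤ x≤m)

  walk : Walk (+ N , + N) W (-2ℤ , 0ℤ)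
  walk =
    walk-++ walk-halfRow halfRow∼ρ₃B₁
      (walk-++ (walk-map ρ₃ ρ₃-∼ (B₁.walk-block k)) ρ₃B₁∼ρ₂B₁
      (walk-++ (walk-map ρ₂ ρ₂-∼ (B₁.walk-block k)) ρ₂B₁∼ρ₁B₁
      (walk-++ (walk-map ρ₁ ρ₁-∼ (B₁.walk-block k)) ρ₁B₁∼B₀
      (walk-++-[] (B₀.walk-block k)))))
    where
    walk-halfRow : Walk (+ N , + N) halfRow (-2ℤ , + N)
    walk-halfRow = walk-++ (walk-descending (row (+ N)) (row-∼ (+ N)) N) (∼-left -1ℤ (+ N))
                    (step (∼-left -2ℤ (+ N)) stop)

    halfRow∼ρ₃B₁ : (-2ℤ , + N) ∼ ρ₃ (+ k , -2ℤ)
    halfRow∼ρ₃B₁ = subst (λ y → (-2ℤ , + N) ∼ (-2ℤ , y)) (sym c-k≡1+N) (∼-up -2ℤ (+ N))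

    ρ₃B₁∼ρ₂B₁ : ρ₃ B₁.exit ∼ ρ₂ (+ k , -2ℤ)
    ρ₃B₁∼ρ₂B₁ = subst (λ x → (+ (k + 1) , c ℤ.- -2ℤ) ∼ (x , c ℤ.- -2ℤ))
                  (trans (cong (+_ ∘ suc) k+1≡N) (sym c-k≡1+N)) (∼-right (+ (k + 1)) (c ℤ.- -2ℤ))

    ρ₂B₁∼ρ₁B₁ : ρ₂ B₁.exit ∼ ρ₁ (+ k , -2ℤ)
    ρ₂B₁∼ρ₁B₁ = subst (λ y → (c ℤ.- -2ℤ , y) ∼ (c ℤ.- -2ℤ , + k)) (sym c-[k+1]≡N)
                  (∼-down (c ℤ.- -2ℤ) (+ k))

    ρ₁B₁∼B₀ : ρ₁ B₁.exit ∼ (+ k , -2ℤ)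
    ρ₁B₁∼B₀ = subst (λ x → (x , -2ℤ) ∼ (+ k , -2ℤ)) (sym c-[k+1]≡N) (∼-left (+ k) -2ℤ)

  HalfRow SW SE NE NW : Point → Set
  HalfRow (x , y) = x ℤ.≤ + N × y ≡ + N
  SW     (x , y) = x ℤ.≤ + k × y ℤ.≤ + k
  SE     (x , y) = + N ℤ.≤ x × y ℤ.≤ + k
  NE     (x , y) = + suc N ℤ.≤ x × + N ℤ.≤ y
  NW     (x , y) = x ℤ.≤ + N × + suc N ℤ.≤ y

  k<N : k < N
  k<N = ℕP.n<1+n k

  N<1+N : N < suc N
  N<1+N = ℕP.n<1+n N

  k<1+N : k < suc N
  k<1+N = ℕP.m<n⇒m<1+n k<N

  halfRow-NW : Separated HalfRow NW
  halfRow-NW (_ , refl) (_ , 1+N≤y) = gap ℤP.≤-refl 1+N≤y N<1+N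

  halfRow-NE : Separated HalfRow NE
  halfRow-NE (x≤N , _) (1+N≤x , _) = gap x≤N 1+N≤x N<1+N

  halfRow-SE : Separated HalfRow SE
  halfRow-SE (_ , refl) (_ , y≤k) = gap y≤k ℤP.≤-refl k<N

  halfRow-SW : Separated HalfRow SW
  halfRow-SW (_ , refl) (_ , y≤k) = gap y≤k ℤP.≤-refl k<N

  NW-NE : Separated NW NE
  NW-NE (x≤N , _) (1+N≤x , _) = gap x≤N 1+N≤x N<1+N

  NW-SE : Separated NW SE
  NW-SE (_ , 1+N≤y) (_ , y≤k) = gap y≤k 1+N≤y k<1+N

  NW-SW : Separated NW SW
  NW-SW (_ , 1+N≤y) (_ , y≤k) = gap y≤k 1+N≤y k<1+N

  NE-SE : Separated NE SE
  NE-SE (_ , N≤y) (_ , y≤k) = gap y≤k N≤y k<N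

  NE-SW : Separated NE SW
  NE-SW (1+N≤x , _) (x≤k , _) = gap x≤k 1+N≤x k<1+N

  SE-SW : Separated SE SW
  SE-SW (N≤x , _) (x≤k , _) = gap x≤k N≤x k<N

  halfRow-in-HalfRow : All (HalfRow ∘ proj₂) halfRow
  halfRow-in-HalfRow =
    AllP.++⁺ (all-descending (row (+ N)) (suc N) (λ i<1+N → ℤ.+≤+ (ℕP.≤-pred i<1+N) , refl))
              ((ℤ.-≤+ , refl) ∷ (ℤ.-≤+ , refl) ∷ [])

  turned-B₁-in : ∀ f {R : Point → Set} → (∀ {p} → B₁.Bounded k p → R (f p)) →
               All (R ∘ proj₂) (mapPoints f (B₁.block k))
  turned-B₁-in f bounded⇒R = AllP.map⁺ (All.map bounded⇒R (B₁.block-bounded k ℕP.≤-refl))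

  reflect-k : ∀ {x} → x ℤ.≤ + k → + suc N ℤ.≤ c ℤ.- x
  reflect-k {x} x≤k = subst (ℤ._≤ c ℤ.- x) c-k≡1+N (reflect-≤ x≤k)

  reflect-k+1 : ∀ {y} → y ℤ.≤ + (k + 1) → + N ℤ.≤ c ℤ.- y
  reflect-k+1 {y} y≤ = subst (ℤ._≤ c ℤ.- y) c-[k+1]≡N (reflect-≤ y≤)

  ρ₃B₁-in-NW : All (NW ∘ proj₂) (mapPoints ρ₃ (B₁.block k))
  ρ₃B₁-in-NW = turned-B₁-in ρ₃ λ {(_ , y)} (x≤ , y≤) →
    subst (λ n → y ℤ.≤ + n) k+1≡N y≤ , reflect-k x≤

  ρ₂B₁-in-NE : All (NE ∘ proj₂) (mapPoints ρ₂ (B₁.block k))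
  ρ₂B₁-in-NE = turned-B₁-in ρ₂ λ (x≤ , y≤) → reflect-k x≤ , reflect-k+1 y≤

  ρ₁B₁-in-SE : All (SE ∘ proj₂) (mapPoints ρ₁ (B₁.block k))
  ρ₁B₁-in-SE = turned-B₁-in ρ₁ λ (x≤ , y≤) → reflect-k+1 y≤ , x≤

  B₀-in-SW : All (SW ∘ proj₂) (B₀.block k)
  B₀-in-SW = All.map (λ {(_ , (_ , y))} (x≤ , y≤) → x≤ , subst (λ n → y ℤ.≤ + n) (ℕP.+-identityʳ k) y≤)
                     (B₀.block-bounded k z≤n)

  selfAvoiding : SelfAvoiding W
  selfAvoiding = AllPairsP.concat⁺
    (selfAvoiding-halfRow ∷ selfAvoiding-mapPoints ρ₃ ρ₃-injective (B₁.selfAvoiding-block k) ∷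
     selfAvoiding-mapPoints ρ₂ ρ₂-injective (B₁.selfAvoiding-block k) ∷
     selfAvoiding-mapPoints ρ₁ ρ₁-injective (B₁.selfAvoiding-block k) ∷ B₀.selfAvoiding-block k ∷ [])
    ((separated-all halfRow-in-HalfRow ρ₃B₁-in-NW halfRow-NW ∷
      separated-all halfRow-in-HalfRow ρ₂B₁-in-NE halfRow-NE ∷
      separated-all halfRow-in-HalfRow ρ₁B₁-in-SE halfRow-SE ∷
      separated-all halfRow-in-HalfRow B₀-in-SW halfRow-SW ∷ []) ∷
     (separated-all ρ₃B₁-in-NW ρ₂B₁-in-NE NW-NE ∷
      separated-all ρ₃B₁-in-NW ρ₁B₁-in-SE NW-SE ∷
      separated-all ρ₃B₁-in-NW B₀-in-SW NW-SW ∷ []) ∷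
     (separated-all ρ₂B₁-in-NE ρ₁B₁-in-SE NE-SE ∷
      separated-all ρ₂B₁-in-NE B₀-in-SW NE-SW ∷ []) ∷
     (separated-all ρ₁B₁-in-SE B₀-in-SW SE-SW ∷ []) ∷ [] ∷ [])
    where
    selfAvoiding-halfRow : SelfAvoiding halfRow
    selfAvoiding-halfRow = AllPairsP.++⁺ (selfAvoiding-descending (row (+ N)) (row-injective (+ N)) (suc N))
      ((distinct (λ ()) ∷ []) ∷ [] ∷ [])
      (all-descending (row (+ N)) (suc N) (λ _ → distinct (λ ()) ∷ distinct (λ ()) ∷ []))

  Square : Point → Set
  Square = InSquare 0ℤ 0ℤ (2 * N)

  in-range : ∀ {i} → i ≤ 2 * N → 0ℤ ℤ.≤ + i × + i ℤ.≤ c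
  in-range i≤ = ℤ.+≤+ z≤n , ℤ.+≤+ i≤

  reflected-in-range : ∀ {t} → t ≤ 2 * N → 0ℤ ℤ.≤ c ℤ.- + t × c ℤ.- + t ℤ.≤ c
  reflected-in-range {t} t≤ rewrite c-+≡ t≤ = in-range (ℕP.m∸n≤m (2 * N) t)

  in-range-≤k+1 : ∀ {i} → i ≤ k + 1 → 0ℤ ℤ.≤ + i × + i ℤ.≤ c
  in-range-≤k+1 i≤ = in-range (ℕP.≤-trans i≤ (subst (_≤ 2 * N) (sym k+1≡N) N≤2N))

  reflected-in-range-≤k+1 : ∀ {i} → i ≤ k + 1 → 0ℤ ℤ.≤ c ℤ.- + i × c ℤ.- + i ℤ.≤ c
  reflected-in-range-≤k+1 i≤ = reflected-in-range (ℕP.≤-trans i≤ (subst (_≤ 2 * N) (sym k+1≡N) N≤2N))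

  halfRow-zeros : ∀ {p} → (b0 , p) ∈ halfRow → Square p
  halfRow-zeros z∈ with ∈-++⁻ (descending b0 (row (+ N)) (suc N)) z∈
  ... | inj₁ z∈row with AnyP.applyDownFrom⁻ _ z∈row
  ...   | _ , i<1+N , refl = in-range (ℕP.≤-trans (ℕP.≤-pred i<1+N) N≤2N) , in-range N≤2N
  halfRow-zeros _ | inj₂ (here ())
  halfRow-zeros _ | inj₂ (there (here ()))

  turned-B₁-zeros : ∀ f → (∀ {i t} → i ≤ k + 1 → t ≤ k + 1 → Square (f (+ i , + t))) →
                    ∀ {p} → (b0 , p) ∈ mapPoints f (B₁.block k) → Square p
  turned-B₁-zeros f square z∈ with ∈-map⁻ (map₂ f) z∈
  ... | (b0 , _) , z∈B₁ , refl with B₁.zero∈block⇒box z∈B₁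
  ...   | B₁.box i≤k t≤k+1 = square (ℕP.m≤n⇒m≤n+o 1 i≤k) t≤k+1

  B₀-zeros : ∀ {p} → (b0 , p) ∈ B₀.block k → Square p
  B₀-zeros z∈ with B₀.zero∈block⇒box z∈
  ... | B₀.box i≤k t≤k+0 =
    in-range-≤k+1 (ℕP.m≤n⇒m≤n+o 1 i≤k) , in-range-≤k+1 (ℕP.≤-trans t≤k+0 (ℕP.+-monoʳ-≤ k z≤n))

  zeros-in-square : All (λ P → ∀ {p} → (b0 , p) ∈ P → Square p) parts
  zeros-in-square =
    halfRow-zeros ∷
    turned-B₁-zeros ρ₃ (λ i≤ t≤ → in-range-≤k+1 t≤ , reflected-in-range-≤k+1 i≤) ∷
    turned-B₁-zeros ρ₂ (λ i≤ t≤ → reflected-in-range-≤k+1 i≤ , reflected-in-range-≤k+1 t≤) ∷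
    turned-B₁-zeros ρ₁ (λ i≤ t≤ → reflected-in-range-≤k+1 t≤ , in-range-≤k+1 i≤) ∷
    B₀-zeros ∷ []

  2N∸x≤N : ∀ {x} → N ≤ x → 2 * N ∸ x ≤ N
  2N∸x≤N {x} N≤x = subst (2 * N ∸ x ≤_) 2N∸N≡N (ℕP.∸-monoʳ-≤ (2 * N) N≤x)

  2N∸x≤k : ∀ {x} → suc N ≤ x → 2 * N ∸ x ≤ k
  2N∸x≤k {x} N<x = subst (2 * N ∸ x ≤_) 2N∸[1+N]≡k (ℕP.∸-monoʳ-≤ (2 * N) N<x)

  ∈-turned-B₁ : ∀ f {i t} → i ≤ k → t ≤ N → (b0 , f (+ i , + t)) ∈ mapPoints f (B₁.block k)
  ∈-turned-B₁ f {t = t} i≤k t≤N =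
    ∈-map⁺ (map₂ f) (B₁.box∈block k (B₁.box i≤k (subst (t ≤_) (sym k+1≡N) t≤N)))

  cover : ∀ {x y} → x ≤ 2 * N → y ≤ 2 * N → Any ((b0 , (+ x , + y)) ∈_) parts
  cover {x} {y} x≤ y≤ with y ℕP.≤? k | x ℕP.≤? k | y ℕP.≤? N | x ℕP.≤? N
  ... | yes y≤k | yes x≤k | _ | _ =
    there (there (there (there (here (B₀.box∈block k (B₀.box x≤k (ℕP.m≤n⇒m≤n+o 0 y≤k)))))))
  ... | yes y≤k | no x≰k | _ | _ =
    there (there (there (here (subst (λ z → (b0 , (z , + y)) ∈ _) (c-[2N∸x]≡x x≤)
      (∈-turned-B₁ ρ₁ y≤k (2N∸x≤N (ℕP.≰⇒> x≰k)))))))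
  ... | no y≰k | _ | yes y≤N | yes x≤N =
    here (subst (λ z → (b0 , (+ x , + z)) ∈ halfRow) (ℕP.≤-antisym (ℕP.≰⇒> y≰k) y≤N)
      (∈-++⁺ˡ (∈-descending (row (+ N)) (s≤s x≤N))))
  ... | no y≰k | _ | _ | no x≰N =
    there (there (here (subst (λ p → (b0 , p) ∈ _) (cong₂ _,_ (c-[2N∸x]≡x x≤) (c-[2N∸x]≡x y≤))
      (∈-turned-B₁ ρ₂ (2N∸x≤k (ℕP.≰⇒> x≰N)) (2N∸x≤N (ℕP.≰⇒> y≰k))))))
  ... | no y≰k | _ | no y≰N | yes x≤N =
    there (here (subst (λ z → (b0 , (+ x , z)) ∈ _) (c-[2N∸x]≡x y≤)
      (∈-turned-B₁ ρ₃ (2N∸x≤k (ℕP.≰⇒> y≰N)) x≤N)))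

  zero∈⇔square : ∀ p → (b0 , p) ∈ W ⇔ Square p
  zero∈⇔square p = mk⇔ zero∈⇒square square⇒zero∈
    where
    zero∈⇒square : ∀ {p} → (b0 , p) ∈ W → Square p
    zero∈⇒square z∈ with ∈-concat⁻′ parts z∈
    ... | _ , z∈P , P∈parts = All.lookup zeros-in-square P∈parts z∈P

    square⇒zero∈ : ∀ {p} → Square p → (b0 , p) ∈ W
    square⇒zero∈ {+ x , + y}       ((_ , ℤ.+≤+ x≤) , (_ , ℤ.+≤+ y≤)) = ∈-concat⁺ (cover x≤ y≤)
    square⇒zero∈ { -[1+ _ ] , _}   ((() , _) , _)
    square⇒zero∈ {+ _ , -[1+ _ ]} (_ , (() , _))

  shortRuns : ShortRuns (2 * N) W
  shortRuns = shortRuns-concat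
    (shortRuns-zeros (descending b0 (row (+ N)) (suc N))
       (all-descending (row (+ N)) (suc N) (λ _ → refl))
       (subst (_≤ 2 * N) (sym (LP.length-applyDownFrom (λ i → b0 , row (+ N) i) (suc N))) 1+N≤2N)
       (shortRuns-ones (refl ∷ [])) ∷
     shortRuns-map ρ₃ _ (B₁.shortRuns-block k B₁-hooks) ∷
     shortRuns-map ρ₂ _ (B₁.shortRuns-block k B₁-hooks) ∷
     shortRuns-map ρ₁ _ (B₁.shortRuns-block k B₁-hooks) ∷
     B₀.shortRuns-block k B₀-hooks ∷ [])
    where
    B₁-hooks : suc (k + 1) + k ≤ 2 * N
    B₁-hooks = ℕP.≤-reflexive (eq k)
      where eq : ∀ k → suc (k + 1) + k ≡ 2 * suc k
            eq = ℕSolver.solve-∀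
    B₀-hooks : suc (k + 0) + k ≤ 2 * N
    B₀-hooks = ℕP.<⇒≤ (ℕP.≤-reflexive (eq k))
      where eq : ∀ k → suc (suc (k + 0) + k) ≡ 2 * suc k
            eq = ℕSolver.solve-∀

theorem2p16 : ∀ (n : ℕ) → n ≥ 1 →
    ∃[ m ] Σ (Word m) λ w → Σ (Fold w) λ P →
      (∃[ a ] ∃[ b ] (∀ (p : Point) → OccupiedByZero w P p ⇔ InSquare a b (2 * n) p))
      × ¬ Factor (replicate (2 * n + 1) b0) (toList w)
theorem2p16 (suc k) _ =
  length W , letters W , walk⇒fold walk selfAvoiding ,
  (0ℤ , 0ℤ , λ p → ⇔-trans (occupiedByZero⇔∈ walk selfAvoiding p) (zero∈⇔square p)) ,
  shortRuns⇒¬Factor shortRuns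
  where open Assembly k
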